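{- For arbitrary star-finite pointed simplicial models $(\mathcal C,X)$ and $(\mathcal C',X')$, \[ (\mathcal C,X)\equiv_{\mathcal L^+}(\mathcal C',X') \quad\Longleftrightarrow\quad (\mathcal C,X)\mathrel{\underline{\leftrightarrow}}(\mathcal C',X'). \]
   Context: Let $A$ be a finite set of agents and, for each $a\in A$, $P_a$ a countable set of local atoms (mutually disjoint). The language $\mathcal L^+$ is $\varphi ::= a \mid p_a \mid \neg\varphi \mid (\varphi\wedge\varphi)\mid \widehat K_a\varphi$ with $a\in A$ (global atom "agent $a$ is alive") and $p_a\in P_a$. A simplicial model $\mathcal C=(C,\chi,\ell)$ consists of a nonempty downward-closed set $C$ of nonempty finite subsets (simplexes) of a vertex set containing all singletons, a chromatic map $\chi$ from vertices to agents injective on each simplex, and a valuation $\ell$ assigning to each vertex $v$ a subset of $P_{\chi(v)}$; $\chi(X)$ and $\ell(X)$ are the unions over vertices of $X$; $\mathcal F(C)$ is the set of facets; a pointed model is $(\mathcal C,X)$ with $X\in\mathcal F(C)$. A simplicial model is star-finite iff for each agent $a$, every facet has only finitely many facets $Y$ with $a\in\chi(X\cap Y)$. Three-valued semantics on facets: definability $\bowtie$: $a$ always defined; $p_a$ defined iff $a\in\chi(X)$; $\neg\varphi$ defined iff $\varphi$ is; $\varphi\wedge\psi$ defined iff both are; $\widehat K_a\varphi$ defined iff $\varphi$ is defined in some facet $Y$ with $a\in\chi(X\cap Y)$. Truth $\vDash$: $a$ true iff $a\in\chi(X)$; $p_a$ true iff $p_a\in\ell(X)$; $\neg\varphi$ true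 iff $\varphi$ defined and not true; $\varphi\wedge\psi$ true iff both true; $\widehat K_a\varphi$ true iff $\varphi$ true in some facet $Y$ with $a\in\chi(X\cap Y)$. $(\mathcal C,X)\equiv_{\mathcal L^+}(\mathcal C',X')$ means that for every $\varphi\in\mathcal L^+$, $\varphi$ is defined/true/has true negation in $(\mathcal C,X)$ iff the same holds in $(\mathcal C',X')$. A bisimulation between $\mathcal C$ and $\mathcal C'$ is a nonempty relation $\mathcal B\subseteq\mathcal F(C)\times\mathcal F(C')$ such that whenever $X\mathcal B X'$: (atoms) $\chi(X)=\chi'(X')$ and $\ell(X)=\ell'(X')$; (forth) for each $a$ and each facet $Y$ with $a\in\chi(X\cap Y)$ there is a facet $Y'$ with $a\in\chi'(X'\cap Y')$ and $Y\mathcal B Y'$; (back) symmetrically. $(\mathcal C,X)\mathrel{\underline{\leftrightarrow}}(\mathcal C',X')$ means there is a bisimulation relating $X$ and $X'$. -}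

module Defs where

open import Level using (0ℓ)
open import Data.Nat using (ℕ)
open import Data.Fin using (Fin)
open import Data.List using (List; []; _∷_)
open import Data.List.Membership.Propositional using (_∈_)
open import Data.Product using (Σ; ∃; _×_; _,_)
open import Data.Unit using (⊤)
open import Relation.Nullary using (¬_)
open import Relation.Binary.PropositionalEquality using (_≡_)
open import Function.Definitions using (Injective)
open import Function.Bundles using (_⇔_)

-- Agents: the finite set Fin n.  Local atoms of agent a: the type P a
-- (the local atom sets are mutually disjoint by construction: a global
-- atom is a pair (a , p) with p : P a).

Countable : ∀ {n} → (Fin n → Set) → Set
Countable {n} P = (a : Fin n) → Σ (P a → ℕ) (λ f → Injective _≡_ _≡_ f)

module _ {n : ℕ} (P : Fin n → Set) where

  Agent : Set
  Agent = Fin n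

  data Form : Set where
    alive : Agent → Form
    atom  : (a : Agent) → P a → Form
    ¬'_   : Form → Form
    _∧'_  : Form → Form → Form
    K̂     : Agent → Form → Form

  -- Simplexes are finite sets of vertices, represented by lists
  -- (only membership matters; C is required to respect set equality).
  record SModel : Set₁ where
    field
      V          : Set
      C          : List V → Set
      C-inhabited : Σ (List V) C
      C-ext      : ∀ {X Y} → (∀ v → (v ∈ X) ⇔ (v ∈ Y)) → C X → C Y
      C-nonempty : ∀ {X} → C X → Σ V (λ v → v ∈ X)
      C-down     : ∀ {X Y} → C X → (∀ {v} → v ∈ Y → v ∈ X) →
                   Σ V (λ v → v ∈ Y) → C Y
      C-singl    : ∀ v → C (v ∷ [])
      χ          : V → Agent
      χ-inj      : ∀ {X} → C X → ∀ {u v} → u ∈ X → v ∈ X → χ u ≡ χ v → u ≡ v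
      ℓ          : V → (a : Agent) → P a → Set
      ℓ-local    : ∀ {v a p} → ℓ v a p → χ v ≡ a

  module _ (M : SModel) where
    open SModel M

    SetEq : List V → List V → Set
    SetEq X Y = ∀ v → (v ∈ X) ⇔ (v ∈ Y)

    IsFacet : List V → Set
    IsFacet X = C X × (∀ Y → C Y → (∀ {v} → v ∈ X → v ∈ Y) → ∀ {v} → v ∈ Y → v ∈ X)

    _∈χ_ : Agent → List V → Set
    a ∈χ X = Σ V (λ v → v ∈ X × χ v ≡ a)

    _∈χ∩_,_ : Agent → List V → List V → Set
    a ∈χ∩ X , Y = Σ V (λ v → v ∈ X × v ∈ Y × χ v ≡ a)

    _∈ℓ_ : Σ Agent P → List V → Set
    (a , p) ∈ℓ X = Σ V (λ v → v ∈ X × ℓ v a p)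

    Def : Form → List V → Set
    Def (alive a) X = ⊤
    Def (atom a p) X = a ∈χ X
    Def (¬' φ) X = Def φ X
    Def (φ ∧' ψ) X = Def φ X × Def ψ X
    Def (K̂ a φ) X = Σ (List V) (λ Y → IsFacet Y × a ∈χ∩ X , Y × Def φ Y)

    Tru : Form → List V → Set
    Tru (alive a) X = a ∈χ X
    Tru (atom a p) X = (a , p) ∈ℓ X
    Tru (¬' φ) X = Def φ X × ¬ Tru φ X
    Tru (φ ∧' ψ) X = Tru φ X × Tru ψ X
    Tru (K̂ a φ) X = Σ (List V) (λ Y → IsFacet Y × a ∈χ∩ X , Y × Tru φ Y)

    StarFinite : Set
    StarFinite = ∀ (a : Agent) X → IsFacet X →
      Σ (List (List V)) (λ L → ∀ Y → IsFacet Y → a ∈χ∩ X , Y →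
        Σ (List V) (λ Z → Z ∈ L × SetEq Y Z))

  module _ (M M' : SModel) where
    private
      module M = SModel M
      module M' = SModel M'

    LEquiv : List M.V → List M'.V → Set
    LEquiv X X' = ∀ (φ : Form) →
      (Def M φ X ⇔ Def M' φ X') ×
      (Tru M φ X ⇔ Tru M' φ X') ×
      (Tru M (¬' φ) X ⇔ Tru M' (¬' φ) X')

    IsBisimulation : (List M.V → List M'.V → Set) → Set
    IsBisimulation B = ∀ {X X'} → B X X' →
      (IsFacet M X × IsFacet M' X') ×
      (∀ a → _∈χ_ M a X ⇔ _∈χ_ M' a X') ×
      (∀ q → _∈ℓ_ M q X ⇔ _∈ℓ_ M' q X') ×
      (∀ a Y → IsFacet M Y → _∈χ∩_,_ M a X Y →
         Σ (List M'.V) (λ Y' → IsFacet M' Y' × _∈χ∩_,_ M' a X' Y' × B Y Y')) ×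
      (∀ a Y' → IsFacet M' Y' → _∈χ∩_,_ M' a X' Y' →
         Σ (List M.V) (λ Y → IsFacet M Y × _∈χ∩_,_ M a X Y × B Y Y'))

    -- (C,X) ↔ (C',X')  (B is nonempty since it relates X and X')
    Bisimilar : List M.V → List M'.V → Set₁
    Bisimilar X X' = Σ (List M.V → List M'.V → Set) (λ B → IsBisimulation B × B X X')

{-# OPTIONS --safe #-}

-- Bisimilar facets agree on definedness and truth of every formula, by induction on the
-- formula.  Conversely, ≡_{L⁺} between facets is a bisimulation: if an a-neighbour Y of X
-- had no ≡-equivalent a-neighbour of X', a formula ψ true at Y and untrue at each of the
-- finitely many (star-finiteness) a-neighbours of X' would make K̂_a ψ true at X only.
-- Such separating formulas exist because undefinedness is witnessed by truth: if φ is
-- undefined at a facet Y, some formula is true at Y and untrue wherever φ is defined, so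
-- inclusion of true formulas already yields ≡_{L⁺}.  Definedness of φ is a positive
-- condition (its shape) built from aliveness, conjunction and ◇.  When ◇_b E fails at Y,
-- the witness is ¬K̂_b G, where G expresses the last of the successive weakenings of E
-- that still fails at every b-neighbour of Y: G is then defined at some b-neighbour of Y
-- but true at none.

module Submission where

open import Defs
open import Level using (0ℓ)
open import Axiom.ExcludedMiddle using (ExcludedMiddle)
open import Axiom.DoubleNegationElimination using (DoubleNegationElimination; em⇒dne)
open import Data.Nat using (ℕ; zero; suc; pred; _+_; _∸_; _≤_; z≤n; s≤s)
open import Data.Nat.GeneralisedArithmetic using (fold)
open import Data.Nat.Properties
  using (≤-refl; ≤-trans; +-mono-≤; +-monoʳ-≤; pred[n]≤n; pred-mono-≤;
         pred[m∸n]≡m∸[1+n]; n∸n≡0; n≤0⇒n≡0; m+n≡0⇒m≡0; m+n≡0⇒n≡0; module ≤-Reasoning)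
open import Data.Fin using (Fin)
open import Data.List using (List; []; _∷_; filter)
open import Data.List.Membership.Propositional using (_∈_)
open import Data.List.Membership.Propositional.Properties using (∈-filter⁺; ∈-filter⁻)
open import Data.List.Relation.Unary.Any using (here; there)
open import Data.Product using (Σ; ∃; _×_; _,_; proj₁; proj₂)
open import Data.Unit using (⊤; tt)
open import Data.Empty using (⊥-elim)
open import Function.Base using (_∘_; flip)
open import Function.Bundles using (_⇔_; mk⇔; Equivalence)
open import Function.Properties.Equivalence using () renaming (sym to ⇔-sym)
open import Relation.Nullary using (¬_; yes; no)
open import Relation.Unary using (Decidable)
open import Relation.Binary.PropositionalEquality using (_≡_; refl)

open Equivalence using (to; from)

crossing : ExcludedMiddle 0ℓ → (Q : ℕ → Set) → ¬ Q 0 → ∀ m → Q m →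
           ∃ λ k → ¬ Q k × Q (suc k)
crossing em Q ¬Q₀ zero    Q₀ = ⊥-elim (¬Q₀ Q₀)
crossing em Q ¬Q₀ (suc m) Qₘ₊₁ with em {Q m}
... | yes Qₘ = crossing em Q ¬Q₀ m Qₘ
... | no ¬Qₘ = m , ¬Qₘ , Qₘ₊₁

pred+pred≤pred[+] : ∀ m n → pred m + pred n ≤ pred (m + n)
pred+pred≤pred[+] zero    n = ≤-refl
pred+pred≤pred[+] (suc m) n = +-monoʳ-≤ m pred[n]≤n

module _ {n : ℕ} (P : Fin n → Set) where

  -- The agent of `always` only serves to write a tautology in `formula`.
  data Shape : Set where
    always : Fin n → Shape
    lives  : Fin n → Shape
    _&_    : Shape → Shape → Shape
    ◇      : Fin n → Shape → Shape

  Holds : (M : SModel P) → Shape → List (SModel.V M) → Set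
  Holds M (always _) X = ⊤
  Holds M (lives a)  X = _∈χ_ P M a X
  Holds M (E & F)    X = Holds M E X × Holds M F X
  Holds M (◇ b E)    X =
    Σ (List (SModel.V M)) λ Y → IsFacet P M Y × _∈χ∩_,_ P M b X Y × Holds M E Y

  shape : Form P → Shape
  shape (alive a)  = always a
  shape (atom a _) = lives a
  shape (¬' φ)     = shape φ
  shape (φ ∧' ψ)   = shape φ & shape ψ
  shape (K̂ b φ)    = ◇ b (shape φ)

  defined : Form P → Form P
  defined φ = ¬' ((¬' φ) ∧' (¬' (¬' φ)))

  formula : Shape → Form P
  formula (always a) = defined (alive a)
  formula (lives a)  = alive a
  formula (E & F)    = formula E ∧' formula F
  formula (◇ b E)    = K̂ b (formula E)

  size : Shape → ℕ
  size (always _) = 0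
  size (lives _)  = 1
  size (E & F)    = size E + size F
  size (◇ _ E)    = 2 + size E

  -- At facets, Def (formula E) is Holds (weaken E).  ◇⁻ replaces ◇ b over a shape that
  -- holds everywhere by the equivalent `lives b`, so that weakening strictly lowers the size.
  ◇⁻ : Fin n → Shape → Shape
  ◇⁻ b E with size E
  ... | zero  = lives b
  ... | suc _ = ◇ b E

  weaken : Shape → Shape
  weaken (always a) = always a
  weaken (lives a)  = always a
  weaken (E & F)    = weaken E & weaken F
  weaken (◇ b E)    = ◇⁻ b (weaken E)

  weaken^ : ℕ → Shape → Shape
  weaken^ k E = fold E weaken k

  size-weaken : ∀ E → size (weaken E) ≤ pred (size E)
  size-weaken (always _) = z≤n
  size-weaken (lives _)  = z≤n
  size-weaken (E & F)    =
    ≤-trans (+-mono-≤ (size-weaken E) (size-weaken F)) (pred+pred≤pred[+] (size E) (size F))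
  size-weaken (◇ b E) with size (weaken E) in eq | size E | size-weaken E
  ... | zero  | _     | _ = s≤s z≤n
  ... | suc _ | zero  | ()
  ... | suc _ | suc _ | h rewrite eq = s≤s (s≤s h)

  size-weaken^ : ∀ k E → size (weaken^ k E) ≤ size E ∸ k
  size-weaken^ zero    E = ≤-refl
  size-weaken^ (suc k) E = begin
    size (weaken (weaken^ k E)) ≤⟨ size-weaken (weaken^ k E) ⟩
    pred (size (weaken^ k E))   ≤⟨ pred-mono-≤ (size-weaken^ k E) ⟩
    pred (size E ∸ k)           ≡⟨ pred[m∸n]≡m∸[1+n] (size E) k ⟩
    size E ∸ suc k              ∎
    where open ≤-Reasoning

  size-weaken^-size≡0 : ∀ E → size (weaken^ (size E) E) ≡ 0
  size-weaken^-size≡0 E = n≤0⇒n≡0 (begin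
    size (weaken^ (size E) E) ≤⟨ size-weaken^ (size E) E ⟩
    size E ∸ size E           ≡⟨ n∸n≡0 (size E) ⟩
    0                         ∎)
    where open ≤-Reasoning

  module _ {M : SModel P} where
    open SModel M using (V; ℓ-local)

    Def→Holds-shape : ∀ φ {X} → Def P M φ X → Holds M (shape φ) X
    Def→Holds-shape (alive a)  _                 = tt
    Def→Holds-shape (atom a p) d                 = d
    Def→Holds-shape (¬' φ)     d                 = Def→Holds-shape φ d
    Def→Holds-shape (φ ∧' ψ)   (dφ , dψ)         = Def→Holds-shape φ dφ , Def→Holds-shape ψ dψ
    Def→Holds-shape (K̂ b φ)    (Y , fY , bXY , d) = Y , fY , bXY , Def→Holds-shape φ d

    Holds-shape→Def : ∀ φ {X} → Holds M (shape φ) X → Def P M φ X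
    Holds-shape→Def (alive a)  _                 = tt
    Holds-shape→Def (atom a p) h                 = h
    Holds-shape→Def (¬' φ)     h                 = Holds-shape→Def φ h
    Holds-shape→Def (φ ∧' ψ)   (hφ , hψ)         = Holds-shape→Def φ hφ , Holds-shape→Def ψ hψ
    Holds-shape→Def (K̂ b φ)    (Y , fY , bXY , h) = Y , fY , bXY , Holds-shape→Def φ h

    Tru⇒Def : ∀ φ {X} → Tru P M φ X → Def P M φ X
    Tru⇒Def (alive a)  _                 = tt
    Tru⇒Def (atom a p) (v , v∈X , ℓv)    = v , v∈X , ℓ-local ℓv
    Tru⇒Def (¬' φ)     (d , _)           = d
    Tru⇒Def (φ ∧' ψ)   (tφ , tψ)         = Tru⇒Def φ tφ , Tru⇒Def ψ tψ
    Tru⇒Def (K̂ b φ)    (Y , fY , bXY , t) = Y , fY , bXY , Tru⇒Def φ t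

    Tru-defined⇔Def : ∀ φ {X} → Tru P M (defined φ) X ⇔ Def P M φ X
    Tru-defined⇔Def φ = mk⇔ (λ ((d , _) , _) → d) λ d → (d , d) , λ ((_ , ¬t) , (_ , ¬¬t)) → ¬¬t (d , ¬t)

    Tru-formula→Holds : ∀ E {X} → Tru P M (formula E) X → Holds M E X
    Tru-formula→Holds (always a) _                 = tt
    Tru-formula→Holds (lives a)  t                 = t
    Tru-formula→Holds (E & F)    (tE , tF)         = Tru-formula→Holds E tE , Tru-formula→Holds F tF
    Tru-formula→Holds (◇ b E)    (Y , fY , bXY , t) = Y , fY , bXY , Tru-formula→Holds E t

    Holds→Tru-formula : ∀ E {X} → Holds M E X → Tru P M (formula E) X
    Holds→Tru-formula (always a) _                 = from (Tru-defined⇔Def (alive a)) tt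
    Holds→Tru-formula (lives a)  h                 = h
    Holds→Tru-formula (E & F)    (hE , hF)         = Holds→Tru-formula E hE , Holds→Tru-formula F hF
    Holds→Tru-formula (◇ b E)    (Y , fY , bXY , h) = Y , fY , bXY , Holds→Tru-formula E h

    size≡0⇒Holds : ∀ E → size E ≡ 0 → ∀ {X} → Holds M E X
    size≡0⇒Holds (always _) _  = tt
    size≡0⇒Holds (E & F)    eq =
      size≡0⇒Holds E (m+n≡0⇒m≡0 (size E) eq) , size≡0⇒Holds F (m+n≡0⇒n≡0 (size E) eq)

    Holds-◇⇒Holds-◇⁻ : ∀ b E {X} → Holds M (◇ b E) X → Holds M (◇⁻ b E) X
    Holds-◇⇒Holds-◇⁻ b E h with size E
    Holds-◇⇒Holds-◇⁻ b E (_ , _ , (v , v∈X , _ , χv) , _) | zero  = v , v∈X , χv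
    Holds-◇⇒Holds-◇⁻ b E h                                | suc _ = h

    Holds-◇⁻⇒Holds-◇ : ∀ b E {X} → IsFacet P M X → Holds M (◇⁻ b E) X → Holds M (◇ b E) X
    Holds-◇⁻⇒Holds-◇ b E {X} fX h with size E in eq
    Holds-◇⁻⇒Holds-◇ b E {X} fX (v , v∈X , χv) | zero  = X , fX , (v , v∈X , v∈X , χv) , size≡0⇒Holds E eq
    Holds-◇⁻⇒Holds-◇ b E {X} fX h              | suc _ = h

    Holds-weaken : ∀ E {X} → Holds M E X → Holds M (weaken E) X
    Holds-weaken (always a) _                 = tt
    Holds-weaken (lives a)  _                 = tt
    Holds-weaken (E & F)    (hE , hF)         = Holds-weaken E hE , Holds-weaken F hF
    Holds-weaken (◇ b E)    (Y , fY , bXY , h) = Holds-◇⇒Holds-◇⁻ b (weaken E) (Y , fY , bXY , Holds-weaken E h)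

    Holds-weaken^ : ∀ k E {X} → Holds M E X → Holds M (weaken^ k E) X
    Holds-weaken^ zero    E h = h
    Holds-weaken^ (suc k) E h = Holds-weaken (weaken^ k E) (Holds-weaken^ k E h)

    Holds-weaken⇒Def-formula : ∀ E {X} → IsFacet P M X → Holds M (weaken E) X → Def P M (formula E) X
    Holds-weaken⇒Def-formula (always a) _  _         = tt , tt
    Holds-weaken⇒Def-formula (lives a)  _  _         = tt
    Holds-weaken⇒Def-formula (E & F)    fX (hE , hF) =
      Holds-weaken⇒Def-formula E fX hE , Holds-weaken⇒Def-formula F fX hF
    Holds-weaken⇒Def-formula (◇ b E)    fX h         =
      let (Y , fY , bXY , h′) = Holds-◇⁻⇒Holds-◇ b (weaken E) fX h
      in Y , fY , bXY , Holds-weaken⇒Def-formula E fY h′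

    SetEq-sym : ∀ {X Z} → SetEq P M X Z → SetEq P M Z X
    SetEq-sym X≈Z v = ⇔-sym (X≈Z v)

    ∃∈-resp-SetEq : ∀ {X Z} {R : V → Set} → SetEq P M X Z →
                    Σ V (λ v → v ∈ X × R v) → Σ V (λ v → v ∈ Z × R v)
    ∃∈-resp-SetEq X≈Z (v , v∈X , r) = v , to (X≈Z v) v∈X , r

    Def-resp-SetEq : ∀ φ {X Z} → SetEq P M X Z → Def P M φ X → Def P M φ Z
    Def-resp-SetEq (alive a)  X≈Z _                 = tt
    Def-resp-SetEq (atom a p) X≈Z d                 = ∃∈-resp-SetEq X≈Z d
    Def-resp-SetEq (¬' φ)     X≈Z d                 = Def-resp-SetEq φ X≈Z d
    Def-resp-SetEq (φ ∧' ψ)   X≈Z (dφ , dψ)         = Def-resp-SetEq φ X≈Z dφ , Def-resp-SetEq ψ X≈Z dψ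
    Def-resp-SetEq (K̂ b φ)    X≈Z (Y , fY , bXY , d) = Y , fY , ∃∈-resp-SetEq X≈Z bXY , d

    Tru-resp-SetEq : ∀ φ {X Z} → SetEq P M X Z → Tru P M φ X → Tru P M φ Z
    Tru-resp-SetEq (alive a)  X≈Z t                 = ∃∈-resp-SetEq X≈Z t
    Tru-resp-SetEq (atom a p) X≈Z t                 = ∃∈-resp-SetEq X≈Z t
    Tru-resp-SetEq (¬' φ)     X≈Z (d , ¬t)          =
      Def-resp-SetEq φ X≈Z d , ¬t ∘ Tru-resp-SetEq φ (SetEq-sym X≈Z)
    Tru-resp-SetEq (φ ∧' ψ)   X≈Z (tφ , tψ)         = Tru-resp-SetEq φ X≈Z tφ , Tru-resp-SetEq ψ X≈Z tψ
    Tru-resp-SetEq (K̂ b φ)    X≈Z (Y , fY , bXY , t) = Y , fY , ∃∈-resp-SetEq X≈Z bXY , t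

  Forces : Shape → Form P → Set₁
  Forces E φ = ∀ (M : SModel P) X → Holds M E X → Tru P M φ X

  Excludes : Shape → Form P → Set₁
  Excludes E φ = ∀ (M : SModel P) X → Holds M E X → ¬ Tru P M φ X

  FacetEquiv : (M M' : SModel P) → List (SModel.V M) → List (SModel.V M') → Set
  FacetEquiv M M' X X' = IsFacet P M X × IsFacet P M' X' × LEquiv P M M' X X'

  module _ {M M' : SModel P} where
    private
      module M = SModel M
      module M' = SModel M'

    converse : ∀ {B : List M.V → List M'.V → Set} →
               IsBisimulation P M M' B → IsBisimulation P M' M (flip B)
    converse isB XBX' =
      let ((fX , fX') , χ⇔ , ℓ⇔ , forth , back) = isB XBX'
      in (fX' , fX) , ⇔-sym ∘ χ⇔ , ⇔-sym ∘ ℓ⇔ , back , forth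

    LEquiv-sym : ∀ {X X'} → LEquiv P M M' X X' → LEquiv P M' M X' X
    LEquiv-sym X≡X' φ = let (d⇔ , t⇔ , t¬⇔) = X≡X' φ in ⇔-sym d⇔ , ⇔-sym t⇔ , ⇔-sym t¬⇔

    LEquiv⇒Tru⇔ : ∀ {X X'} → LEquiv P M M' X X' → ∀ φ → Tru P M φ X ⇔ Tru P M' φ X'
    LEquiv⇒Tru⇔ X≡X' = proj₁ ∘ proj₂ ∘ X≡X'

    FacetEquiv-sym : ∀ {X X'} → FacetEquiv M M' X X' → FacetEquiv M' M X' X
    FacetEquiv-sym (fX , fX' , X≡X') = fX' , fX , LEquiv-sym X≡X'

    conjunction-separates : ∀ {Y} (a : Fin n) (Zs : List (List M'.V)) →
      (∀ {Z} → Z ∈ Zs → Σ (Form P) λ θ → Tru P M θ Y × ¬ Tru P M' θ Z) →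
      Σ (Form P) λ ψ → Tru P M ψ Y × (∀ {Z} → Z ∈ Zs → ¬ Tru P M' ψ Z)
    conjunction-separates a []       _   = defined (alive a) , from (Tru-defined⇔Def {M} (alive a)) tt , λ ()
    conjunction-separates a (Z ∷ Zs) sep =
      let (θ , tθ , ¬tθ) = sep (here refl)
          (ψ , tψ , ¬tψ) = conjunction-separates a Zs (sep ∘ there)
      in θ ∧' ψ , (tθ , tψ) , λ { (here refl) → ¬tθ ∘ proj₁ ; (there Z∈Zs) → ¬tψ Z∈Zs ∘ proj₂ }

  Def-transfer : ∀ {M M' B} → IsBisimulation P M M' B →
                 ∀ φ {X X'} → B X X' → Def P M φ X → Def P M' φ X'
  Def-transfer isB (alive a)  XBX' _ = tt
  Def-transfer isB (atom a p) XBX' d = let (_ , χ⇔ , _) = isB XBX' in to (χ⇔ a) d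
  Def-transfer isB (¬' φ)     XBX' d = Def-transfer isB φ XBX' d
  Def-transfer isB (φ ∧' ψ)   XBX' (dφ , dψ) = Def-transfer isB φ XBX' dφ , Def-transfer isB ψ XBX' dψ
  Def-transfer isB (K̂ a φ)    XBX' (Y , fY , aXY , d) =
    let (_ , _ , _ , forth , _) = isB XBX'
        (Y' , fY' , aX'Y' , YBY') = forth a Y fY aXY
    in Y' , fY' , aX'Y' , Def-transfer isB φ YBY' d

  Tru-transfer : ∀ {M M' B} → IsBisimulation P M M' B →
                 ∀ φ {X X'} → B X X' → Tru P M φ X → Tru P M' φ X'
  Tru-transfer isB (alive a)  XBX' t = let (_ , χ⇔ , _) = isB XBX' in to (χ⇔ a) t
  Tru-transfer isB (atom a p) XBX' t = let (_ , _ , ℓ⇔ , _) = isB XBX' in to (ℓ⇔ (a , p)) t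
  Tru-transfer {M} {M'} isB (¬' φ) XBX' (d , ¬t) =
    Def-transfer isB φ XBX' d , ¬t ∘ Tru-transfer (converse {M} {M'} isB) φ XBX'
  Tru-transfer isB (φ ∧' ψ)   XBX' (tφ , tψ) = Tru-transfer isB φ XBX' tφ , Tru-transfer isB ψ XBX' tψ
  Tru-transfer isB (K̂ a φ)    XBX' (Y , fY , aXY , t) =
    let (_ , _ , _ , forth , _) = isB XBX'
        (Y' , fY' , aX'Y' , YBY') = forth a Y fY aXY
    in Y' , fY' , aX'Y' , Tru-transfer isB φ YBY' t

  Bisimilar⇒LEquiv : ∀ {M M' X X'} → Bisimilar P M M' X X' → LEquiv P M M' X X'
  Bisimilar⇒LEquiv {M} {M'} (B , isB , XBX') φ =
    mk⇔ (Def-transfer isB φ XBX') (Def-transfer isB˘ φ XBX') ,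
    mk⇔ (Tru-transfer isB φ XBX') (Tru-transfer isB˘ φ XBX') ,
    mk⇔ (Tru-transfer isB (¬' φ) XBX') (Tru-transfer isB˘ (¬' φ) XBX')
    where
      isB˘ : IsBisimulation P M' M (flip B)
      isB˘ = converse {M} {M'} isB

  module _ (em : ExcludedMiddle 0ℓ) where
    private
      dne : DoubleNegationElimination 0ℓ
      dne = em⇒dne em

    module _ {M : SModel P} where
      open SModel M using (V)

      neighbourhood-guard : ∀ {Y b E} → IsFacet P M Y → _∈χ_ P M b Y →
        (∀ U → IsFacet P M U → _∈χ∩_,_ P M b Y U → ¬ Holds M E U) →
        Σ (Form P) λ G → (Σ (List V) λ U → IsFacet P M U × _∈χ∩_,_ P M b Y U × Def P M G U)
                       × (∀ U → IsFacet P M U → _∈χ∩_,_ P M b Y U → ¬ Tru P M G U)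
                       × Forces E G
      neighbourhood-guard {Y} {b} {E} fY (v , v∈Y , χv) unsat =
        let (k , ¬Qₖ , (U , fU , bYU , hU)) =
              crossing em Q (λ (U , fU , bYU , h) → unsat U fU bYU h) (size E) Q-size
        in formula (weaken^ k E) ,
           (U , fU , bYU , Holds-weaken⇒Def-formula (weaken^ k E) fU hU) ,
           (λ U′ fU′ bYU′ t → ¬Qₖ (U′ , fU′ , bYU′ , Tru-formula→Holds (weaken^ k E) t)) ,
           (λ M′ X h → Holds→Tru-formula {M′} (weaken^ k E) (Holds-weaken^ {M′} k E h))
        where
          Q : ℕ → Set
          Q k = Σ (List V) λ U → IsFacet P M U × _∈χ∩_,_ P M b Y U × Holds M (weaken^ k E) U
          Q-size : Q (size E)
          Q-size = Y , fY , (v , v∈Y , v∈Y , χv) ,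
                   size≡0⇒Holds (weaken^ (size E) E) (size-weaken^-size≡0 E)

      undefinedness-witness : ∀ E {Y} → IsFacet P M Y → ¬ Holds M E Y →
        Σ (Form P) λ θ → Tru P M θ Y × Excludes E θ
      undefinedness-witness (always a) fY ¬h = ⊥-elim (¬h tt)
      undefinedness-witness (lives a)  fY ¬h = ¬' alive a , (tt , ¬h) , λ M′ X aX (_ , ¬aX) → ¬aX aX
      undefinedness-witness (E & F) {Y} fY ¬h with em {Holds M E Y}
      ... | yes hE = let (θ , tθ , excl) = undefinedness-witness F fY (¬h ∘ (hE ,_))
                     in θ , tθ , λ M′ X (_ , hF) → excl M′ X hF
      ... | no ¬hE = let (θ , tθ , excl) = undefinedness-witness E fY ¬hE
                     in θ , tθ , λ M′ X (hE , _) → excl M′ X hE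
      undefinedness-witness (◇ b E) {Y} fY ¬h with em {_∈χ_ P M b Y}
      ... | no ¬bY = ¬' alive b , (tt , ¬bY) ,
                     λ M′ X (_ , _ , (v , v∈X , _ , χv) , _) (_ , ¬bX) → ¬bX (v , v∈X , χv)
      ... | yes bY =
        let (G , (U , fU , bYU , dG) , ¬tG , E⊩G) =
              neighbourhood-guard fY bY (λ U fU bYU h → ¬h (U , fU , bYU , h))
        in ¬' K̂ b G , ((U , fU , bYU , dG) , λ (U′ , fU′ , bYU′ , t) → ¬tG U′ fU′ bYU′ t) ,
           λ M′ X (W , fW , bXW , h) (_ , ¬t) → ¬t (W , fW , bXW , E⊩G M′ W h)

    module _ {M M' : SModel P} where
      private
        module M' = SModel M'

      Tru⊆⇒LEquiv : ∀ {Y Z} → IsFacet P M Y → (∀ θ → Tru P M θ Y → Tru P M' θ Z) →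
                    LEquiv P M M' Y Z
      Tru⊆⇒LEquiv {Y} {Z} fY Y⊆Z φ = Def⇔ φ , Tru⇔ φ , Tru⇔ (¬' φ)
        where
          Def⇔ : ∀ φ → Def P M φ Y ⇔ Def P M' φ Z
          Def⇔ φ = mk⇔
            (λ dY → to (Tru-defined⇔Def φ) (Y⊆Z (defined φ) (from (Tru-defined⇔Def φ) dY)))
            (λ dZ → dne λ ¬dY →
              let (θ , tθ , excl) = undefinedness-witness (shape φ) fY (¬dY ∘ Holds-shape→Def φ)
              in excl M' Z (Def→Holds-shape φ dZ) (Y⊆Z θ tθ))
          Tru⇔ : ∀ φ → Tru P M φ Y ⇔ Tru P M' φ Z
          Tru⇔ φ = mk⇔ (Y⊆Z φ) λ tZ → dne λ ¬tY →
            proj₂ (Y⊆Z (¬' φ) (from (Def⇔ φ) (Tru⇒Def φ tZ) , ¬tY)) tZ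

      ¬LEquiv⇒separating : ∀ {Y Z} → IsFacet P M Y → ¬ LEquiv P M M' Y Z →
                           Σ (Form P) λ θ → Tru P M θ Y × ¬ Tru P M' θ Z
      ¬LEquiv⇒separating fY Y≢Z =
        dne λ ¬sep → Y≢Z (Tru⊆⇒LEquiv fY λ θ tY → dne λ ¬tZ → ¬sep (θ , tY , ¬tZ))

      unmatched⇒separated : ∀ {a X' Y} → StarFinite P M' → IsFacet P M' X' → IsFacet P M Y →
        (∀ Y' → IsFacet P M' Y' → _∈χ∩_,_ P M' a X' Y' → ¬ LEquiv P M M' Y Y') →
        Σ (Form P) λ ψ → Tru P M ψ Y ×
                         (∀ Y' → IsFacet P M' Y' → _∈χ∩_,_ P M' a X' Y' → ¬ Tru P M' ψ Y')
      unmatched⇒separated {a} {X'} {Y} sf' fX' fY unmatched =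
        let (ψ , tψ , ¬tψ) = conjunction-separates a relevant separate
        in ψ , tψ , λ Y' fY' aX'Y' tY' →
             let (Z , Z∈Zs , Y'≈Z) = proj₂ (sf' a X' fX') Y' fY' aX'Y'
             in ¬tψ (∈-filter⁺ represents? Z∈Zs (Y' , fY' , aX'Y' , Y'≈Z)) (Tru-resp-SetEq ψ Y'≈Z tY')
        where
          Represents : List M'.V → Set
          Represents Z = Σ (List M'.V) λ Y' →
            IsFacet P M' Y' × _∈χ∩_,_ P M' a X' Y' × SetEq P M' Y' Z
          represents? : Decidable Represents
          represents? Z = em
          Zs : List (List M'.V)
          Zs = proj₁ (sf' a X' fX')
          relevant : List (List M'.V)
          relevant = filter represents? Zs
          separate : ∀ {Z} → Z ∈ relevant → Σ (Form P) λ θ → Tru P M θ Y × ¬ Tru P M' θ Z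
          separate Z∈ =
            let (_ , (Y' , fY' , aX'Y' , Y'≈Z)) = ∈-filter⁻ represents? {xs = Zs} Z∈
                (θ , tθ , ¬tθ) = ¬LEquiv⇒separating fY (unmatched Y' fY' aX'Y')
            in θ , tθ , ¬tθ ∘ Tru-resp-SetEq θ (SetEq-sym {M'} Y'≈Z)

      FacetEquiv-forth : ∀ {X X'} → StarFinite P M' → FacetEquiv M M' X X' →
        ∀ a Y → IsFacet P M Y → _∈χ∩_,_ P M a X Y →
        Σ (List M'.V) λ Y' → IsFacet P M' Y' × _∈χ∩_,_ P M' a X' Y' × FacetEquiv M M' Y Y'
      FacetEquiv-forth sf' (_ , fX' , X≡X') a Y fY aXY = dne λ unmatched →
        let (ψ , tψ , ¬tψ) = unmatched⇒separated sf' fX' fY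
              λ Y' fY' aX'Y' Y≡Y' → unmatched (Y' , fY' , aX'Y' , fY , fY' , Y≡Y')
            (Y' , fY' , aX'Y' , tY') = to (LEquiv⇒Tru⇔ X≡X' (K̂ a ψ)) (Y , fY , aXY , tψ)
        in ¬tψ Y' fY' aX'Y' tY'

    FacetEquiv-isBisimulation : ∀ {M M'} → StarFinite P M → StarFinite P M' →
                                IsBisimulation P M M' (FacetEquiv M M')
    FacetEquiv-isBisimulation {M} {M'} sf sf' X≡X'@(fX , fX' , X≡ᴸX') =
      (fX , fX') ,
      (λ a → LEquiv⇒Tru⇔ X≡ᴸX' (alive a)) ,
      (λ (a , p) → LEquiv⇒Tru⇔ X≡ᴸX' (atom a p)) ,
      FacetEquiv-forth sf' X≡X' ,
      λ a Y' fY' aX'Y' →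
        let (Y , fY , aXY , Y'≡Y) = FacetEquiv-forth {M'} {M} sf (FacetEquiv-sym X≡X') a Y' fY' aX'Y'
        in Y , fY , aXY , FacetEquiv-sym Y'≡Y

    LEquiv⇒Bisimilar : ∀ {M M' X X'} → StarFinite P M → StarFinite P M' →
                       IsFacet P M X → IsFacet P M' X' → LEquiv P M M' X X' → Bisimilar P M M' X X'
    LEquiv⇒Bisimilar {M} {M'} sf sf' fX fX' X≡X' =
      FacetEquiv M M' , FacetEquiv-isBisimulation sf sf' , fX , fX' , X≡X'

theorem4p14 : ExcludedMiddle 0ℓ →
    ∀ {n : ℕ} (P : Fin n → Set) → Countable P →
    (M M' : SModel P) → StarFinite P M → StarFinite P M' →
    (X : List (SModel.V M)) → IsFacet P M X →
    (X' : List (SModel.V M')) → IsFacet P M' X' →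
    (LEquiv P M M' X X' ⇔ Bisimilar P M M' X X')
theorem4p14 em P _ M M' sf sf' X fX X' fX' = mk⇔
  (LEquiv⇒Bisimilar P em {M} {M'} sf sf' fX fX') (Bisimilar⇒LEquiv P)
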